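{- Let $\Phi$ be a derivation in system $\mathcal{V}$ of $\Gamma \vdash^{(m,e,s)} t:\sigma$, and suppose $\Phi$ is tight. Then there exists $p \in \mathsf{no}_v$ such that $t \to_v^{(m,e)} p$, i.e.\ $t$ reduces to $p$ by $\to_v$ using exactly $m$ multiplicative steps and exactly $e$ exponential steps, and $|p|_v = s$.
   Context: Terms. Fix a countably infinite set of variables. Terms are $t,u,r ::= x \mid \lambda x.t \mid t\,u \mid t[x\backslash u]$, where $t[x\backslash u]$ (explicit substitution) binds $x$ in $t$; terms are taken modulo $\alpha$-conversion and $t\{x:=u\}$ is capture-avoiding meta-level substitution. Values are $v ::= x \mid \lambda x.t$. List contexts are $L ::= \square \mid L[x\backslash t]$; $L\langle t\rangle$ plugs $t$ into the hole. CBV normal forms: $\mathsf{vr}_v ::= x \mid \mathsf{vr}_v[x\backslash \mathsf{ne}_v]$; $\mathsf{ne}_v ::= \mathsf{vr}_v\,\mathsf{no}_v \mid \mathsf{ne}_v\,\mathsf{no}_v \mid \mathsf{ne}_v[x\backslash\mathsf{ne}_v]$; $\mathsf{no}_v ::= \lambda x.t \mid \mathsf{vr}_v \mid \mathsf{ne}_v \mid \mathsf{no}_v[x\backslash\mathsf{ne}_v]$. The $v$-size is $|x|_v = 0$, $|\lambda x.t|_v=0$, $|t\,u|_v = |t|_v+|u|_v+1$, $|t[x\backslash u]|_v = |t|_v+|u|_v$. Reduction. Rule $\mathtt{dB}$: $(L\langle\lambda x.t\rangle)\,u\mapsto L\langle t[x\backslash u]\rangle$; rule $\mathtt{sv}$: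 $t[x\backslash L\langle v\rangle]\mapsto L\langle t\{x:=v\}\rangle$ for a value $v$. CBV contexts are $V ::= \square \mid V\,t \mid t\,V \mid V[x\backslash u] \mid t[x\backslash V]$, and $\to_v$ is the closure of $\mathtt{dB}\cup\mathtt{sv}$ under CBV contexts. $\mathtt{dB}$-steps are multiplicative ($m$-steps), $\mathtt{sv}$-steps exponential ($e$-steps); $t\to_v^{(m,e)}p$ means $t$ reduces to $p$ in finitely many $\to_v$ steps, exactly $m$ of them $m$-steps and $e$ of them $e$-steps. Types. Tight types: $\mathtt{tt} ::= \mathtt{n} \mid \mathtt{vl} \mid \mathtt{vr}$. Types $\sigma,\tau ::= \mathtt{tt}\mid\mathcal{M}\mid\mathcal{M}\to\sigma$, with multitypes $\mathcal{M}=[\sigma_i]_{i\in I}$ finite multisets of types ($[\,]$ empty, $\sqcup$ union, $|\mathcal{M}|$ cardinality). Typing contexts $\Gamma$ map variables to multitypes, $[\,]$ for all but finitely many; $(\Gamma+\Delta)(x)=\Gamma(x)\sqcup\Delta(x)$, extended to finite sums; $\Gamma\setminus\!\!\setminus x$ maps $x$ to $[\,]$ and agrees with $\Gamma$ elsewhere. Judgements $\Gamma\vdash^{(m,e,s)} t:\sigma$ carry integer counters. System $\mathcal{V}$ has the rules: (var$_p$) $x:[\mathtt{vr}]\vdash^{(0,0,0)} x:\mathtt{vr}$; (val$_p$) $\emptyset\vdash^{(0,0,0)} x:\mathtt{vl}$; (abs$_p$) $\emptyset\vdash^{(0,0,0)}\lambda x.t:\mathtt{vl}$; (app$_p$) from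 $\Gamma\vdash^{(m,e,s)} t:\mathtt{tt}_1$ with $\mathtt{tt}_1\in\{\mathtt{vr},\mathtt{n}\}$ and $\Delta\vdash^{(m',e',s')} u:\mathtt{tt}_2$ with $\mathtt{tt}_2\in\{\mathtt{vl},\mathtt{n}\}$, infer $\Gamma+\Delta\vdash^{(m+m',e+e',s+s'+1)} t\,u:\mathtt{n}$; (es$_p$) from $\Gamma\vdash^{(m,e,s)} t:\tau$, $\Delta\vdash^{(m',e',s')} u:\mathtt{n}$ and $\Gamma(x)$ tight, infer $(\Gamma\setminus\!\!\setminus x)+\Delta\vdash^{(m+m',e+e',s+s')} t[x\backslash u]:\tau$; (var$_c$) $x:\mathcal{M}\vdash^{(0,1,0)} x:\mathcal{M}$ for any multitype $\mathcal{M}$; (app$_c$) from $\Gamma\vdash^{(m,e,s)} t:[\mathcal{M}\to\tau]$ and $\Delta\vdash^{(m',e',s')} u:\mathcal{M}$, infer $\Gamma+\Delta\vdash^{(m+m'+1,e+e'-1,s+s')} t\,u:\tau$; (appt$_c$) from $\Gamma\vdash^{(m,e,s)} t:[\mathcal{M}\to\tau]$, $\Delta\vdash^{(m',e',s')} u:\mathtt{n}$ and $\mathcal{M}$ tight, infer $\Gamma+\Delta\vdash^{(m+m'+1,e+e'-1,s+s')} t\,u:\tau$; (abs$_c$) from $\Gamma_i\vdash^{(m_i,e_i,s_i)} t:\tau_i$ for each $i\in I$ ($I$ finite, possibly empty), infer $+_{i\in I}(\Gamma_i\setminus\!\!\setminus x)\vdash^{(\sum_i m_i,\,1+\sum_i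 e_i,\,\sum_i s_i)}\lambda x.t:[\Gamma_i(x)\to\tau_i]_{i\in I}$; (es$_c$) from $\Gamma\vdash^{(m,e,s)} t:\sigma$ and $\Delta\vdash^{(m',e',s')} u:\Gamma(x)$, infer $(\Gamma\setminus\!\!\setminus x)+\Delta\vdash^{(m+m',e+e',s+s')} t[x\backslash u]:\sigma$. A multitype is tight if all its elements are tight types; a context is tight if all its multitypes are tight; a derivation of $\Gamma\vdash^{(m,e,s)} t:\sigma$ is tight if $\Gamma$ is tight and $\sigma$ is a tight type. -}

module Defs where

open import Data.Nat using (ℕ; zero; suc; _∸_; _≡ᵇ_; compare; less; equal; greater) renaming (_+_ to _+ℕ_)
open import Data.Integer using (ℤ; +_; 0ℤ; 1ℤ) renaming (_+_ to _+ℤ_; _-_ to _-ℤ_)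
open import Data.List using (List; []; _∷_; _++_; length)
open import Data.List.Relation.Unary.All using (All)
open import Data.Bool using (if_then_else_)
open import Data.Product using (Σ; _×_; _,_; ∃)
open import Relation.Binary.PropositionalEquality using (_≡_)

-- Terms (de Bruijn indices: terms modulo α-conversion).
-- lam t : index 0 in t is the bound variable.
-- es t u : the explicit substitution t[x\u]; index 0 in t is x.

data Tm : Set where
  var : ℕ → Tm
  lam : Tm → Tm
  app : Tm → Tm → Tm
  es  : Tm → Tm → Tm

shift : ℕ → ℕ → Tm → Tm
shift d c (var n) with compare n c
... | less _ _    = var n
... | equal _     = var (n +ℕ d)
... | greater _ _ = var (n +ℕ d)
shift d c (lam t)   = lam (shift d (suc c) t)
shift d c (app t u) = app (shift d c t) (shift d c u)
shift d c (es t u)  = es (shift d (suc c) t) (shift d c u)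

-- sub j s t : capture-avoiding substitution of s for index j in t,
-- decrementing the indices above j (s lives in the scope of the result).
sub : ℕ → Tm → Tm → Tm
sub j s (var n) with compare n j
... | less _ _    = var n
... | equal _     = s
... | greater _ _ = var (n ∸ 1)
sub j s (lam t)   = lam (sub (suc j) (shift 1 0 s) t)
sub j s (app t u) = app (sub j s t) (sub j s u)
sub j s (es t u)  = es (sub (suc j) (shift 1 0 s) t) (sub j s u)

_[0≔_] : Tm → Tm → Tm
t [0≔ v ] = sub 0 v t

data Value : Tm → Set where
  vvar : ∀ n → Value (var n)
  vlam : ∀ t → Value (lam t)

-- List contexts L ::= □ | L[x\r]; the list is written outermost
-- substitution first: (r ∷ L) stands for L[x\r].
LCtx : Set
LCtx = List Tm

plug : LCtx → Tm → Tm
plug []      u = u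
plug (r ∷ L) u = es (plug L u) r

data Kind : Set where
  mul expo : Kind

data _⟶[_]_ : Tm → Kind → Tm → Set where
  dB   : ∀ L t u →
         app (plug L (lam t)) u ⟶[ mul ] plug L (es t (shift (length L) 0 u))
  sv   : ∀ t L v → Value v →
         es t (plug L v) ⟶[ expo ] plug L ((shift (length L) 1 t) [0≔ v ])
  appL : ∀ {t t' k} u → t ⟶[ k ] t' → app t u ⟶[ k ] app t' u
  appR : ∀ {u u' k} t → u ⟶[ k ] u' → app t u ⟶[ k ] app t u'
  esL  : ∀ {t t' k} u → t ⟶[ k ] t' → es t u ⟶[ k ] es t' u
  esR  : ∀ {u u' k} t → u ⟶[ k ] u' → es t u ⟶[ k ] es t u'

data _⟶*⟨_,_⟩_ : Tm → ℕ → ℕ → Tm → Set where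
  done  : ∀ t → t ⟶*⟨ 0 , 0 ⟩ t
  stepm : ∀ {t t' p m e} → t ⟶[ mul ] t' → t' ⟶*⟨ m , e ⟩ p → t ⟶*⟨ suc m , e ⟩ p
  stepe : ∀ {t t' p m e} → t ⟶[ expo ] t' → t' ⟶*⟨ m , e ⟩ p → t ⟶*⟨ m , suc e ⟩ p

data VrV : Tm → Set
data NeV : Tm → Set
data NoV : Tm → Set

data VrV where
  vr-var : ∀ n → VrV (var n)
  vr-es  : ∀ {t u} → VrV t → NeV u → VrV (es t u)

data NeV where
  ne-vr : ∀ {t u} → VrV t → NoV u → NeV (app t u)
  ne-ne : ∀ {t u} → NeV t → NoV u → NeV (app t u)
  ne-es : ∀ {t u} → NeV t → NeV u → NeV (es t u)

data NoV where
  no-lam : ∀ t → NoV (lam t)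
  no-vr  : ∀ {t} → VrV t → NoV t
  no-ne  : ∀ {t} → NeV t → NoV t
  no-es  : ∀ {t u} → NoV t → NeV u → NoV (es t u)

size : Tm → ℕ
size (var _)   = 0
size (lam _)   = 0
size (app t u) = size t +ℕ size u +ℕ 1
size (es t u)  = size t +ℕ size u

-- Types. Multitypes are finite multisets, represented as lists taken up to
-- (deep) permutation equivalence _≈M_.

data Ty : Set where
  tn tvl tvr : Ty
  mult : List Ty → Ty
  arr  : List Ty → Ty → Ty

MTy : Set
MTy = List Ty

data IsTight : Ty → Set where
  tight-n  : IsTight tn
  tight-vl : IsTight tvl
  tight-vr : IsTight tvr

TightM : MTy → Set
TightM M = All IsTight M

data _≈T_ : Ty → Ty → Set
data _≈M_ : MTy → MTy → Set

data _≈T_ where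
  ≈n    : tn ≈T tn
  ≈vl   : tvl ≈T tvl
  ≈vr   : tvr ≈T tvr
  ≈mult : ∀ {M N} → M ≈M N → mult M ≈T mult N
  ≈arr  : ∀ {M N σ τ} → M ≈M N → σ ≈T τ → arr M σ ≈T arr N τ

data _≈M_ where
  []    : [] ≈M []
  _∷_   : ∀ {σ τ M N} → σ ≈T τ → M ≈M N → (σ ∷ M) ≈M (τ ∷ N)
  swap  : ∀ σ τ M → (σ ∷ τ ∷ M) ≈M (τ ∷ σ ∷ M)
  trans : ∀ {M N P} → M ≈M N → N ≈M P → M ≈M P

Ctx : Set
Ctx = ℕ → MTy

∅ : Ctx
∅ _ = []

_↦_ : ℕ → MTy → Ctx
(x ↦ M) y = if y ≡ᵇ x then M else []

_⊕_ : Ctx → Ctx → Ctx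
(Γ ⊕ Δ) y = Γ y ++ Δ y

-- Γ \\ x for the bound variable (index 0), viewed in the outer scope
drop0 : Ctx → Ctx
drop0 Γ y = Γ (suc y)

TightCtx : Ctx → Set
TightCtx Γ = ∀ y → TightM (Γ y)

data VrOrN : Ty → Set where
  vrn-vr : VrOrN tvr
  vrn-n  : VrOrN tn

data VlOrN : Ty → Set where
  vln-vl : VlOrN tvl
  vln-n  : VlOrN tn

data _⊢⟨_,_,_⟩_∶_ : Ctx → ℤ → ℤ → ℤ → Tm → Ty → Set
data AbsPrem (t : Tm) : Ctx → ℤ → ℤ → ℤ → MTy → Set

data _⊢⟨_,_,_⟩_∶_ where
  var-p : ∀ x → (x ↦ (tvr ∷ [])) ⊢⟨ 0ℤ , 0ℤ , 0ℤ ⟩ var x ∶ tvr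
  val-p : ∀ x → ∅ ⊢⟨ 0ℤ , 0ℤ , 0ℤ ⟩ var x ∶ tvl
  abs-p : ∀ t → ∅ ⊢⟨ 0ℤ , 0ℤ , 0ℤ ⟩ lam t ∶ tvl
  app-p : ∀ {Γ Δ m e s m' e' s' t u tt₁ tt₂} →
          Γ ⊢⟨ m , e , s ⟩ t ∶ tt₁ → VrOrN tt₁ →
          Δ ⊢⟨ m' , e' , s' ⟩ u ∶ tt₂ → VlOrN tt₂ →
          (Γ ⊕ Δ) ⊢⟨ m +ℤ m' , e +ℤ e' , (s +ℤ s') +ℤ 1ℤ ⟩ app t u ∶ tn
  es-p  : ∀ {Γ Δ m e s m' e' s' t u τ} →
          Γ ⊢⟨ m , e , s ⟩ t ∶ τ →
          Δ ⊢⟨ m' , e' , s' ⟩ u ∶ tn →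
          TightM (Γ 0) →
          (drop0 Γ ⊕ Δ) ⊢⟨ m +ℤ m' , e +ℤ e' , s +ℤ s' ⟩ es t u ∶ τ
  var-c : ∀ x M → (x ↦ M) ⊢⟨ 0ℤ , 1ℤ , 0ℤ ⟩ var x ∶ mult M
  app-c : ∀ {Γ Δ m e s m' e' s' t u M M' τ} →
          Γ ⊢⟨ m , e , s ⟩ t ∶ mult (arr M τ ∷ []) →
          Δ ⊢⟨ m' , e' , s' ⟩ u ∶ mult M' → M' ≈M M →
          (Γ ⊕ Δ) ⊢⟨ (m +ℤ m') +ℤ 1ℤ , (e +ℤ e') -ℤ 1ℤ , s +ℤ s' ⟩ app t u ∶ τ
  appt-c : ∀ {Γ Δ m e s m' e' s' t u M τ} →
          Γ ⊢⟨ m , e , s ⟩ t ∶ mult (arr M τ ∷ []) →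
          Δ ⊢⟨ m' , e' , s' ⟩ u ∶ tn → TightM M →
          (Γ ⊕ Δ) ⊢⟨ (m +ℤ m') +ℤ 1ℤ , (e +ℤ e') -ℤ 1ℤ , s +ℤ s' ⟩ app t u ∶ τ
  abs-c : ∀ {Γ m e s t M} →
          AbsPrem t Γ m e s M →
          Γ ⊢⟨ m , 1ℤ +ℤ e , s ⟩ lam t ∶ mult M
  es-c  : ∀ {Γ Δ m e s m' e' s' t u σ M} →
          Γ ⊢⟨ m , e , s ⟩ t ∶ σ →
          Δ ⊢⟨ m' , e' , s' ⟩ u ∶ mult M → M ≈M Γ 0 →
          (drop0 Γ ⊕ Δ) ⊢⟨ m +ℤ m' , e +ℤ e' , s +ℤ s' ⟩ es t u ∶ σ

-- The finite family of premises of abs_c: body t typed once per element;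
-- the resulting context is the sum of the premises' contexts with x removed,
-- the resulting multitype is [Γ_i(x) → τ_i]_i and counters are summed.
data AbsPrem t where
  []  : AbsPrem t ∅ 0ℤ 0ℤ 0ℤ []
  _∷_ : ∀ {Γ Δ m e s m' e' s' τ M} →
        Γ ⊢⟨ m , e , s ⟩ t ∶ τ →
        AbsPrem t Δ m' e' s' M →
        AbsPrem t (drop0 Γ ⊕ Δ) (m +ℤ m') (e +ℤ e') (s +ℤ s') (arr (Γ 0) τ ∷ M)

Tight : Ctx → Ty → Set
Tight Γ σ = TightCtx Γ × IsTight σ

-- A reduction step t ⟶ t' turns every derivation of t into one of t' whose counters drop by
-- exactly one m (dB) or one e (sv), with s unchanged, and whose size drops by one. The heart of
-- this is the substitution lemma: the multitype of the substituted variable splits the typing of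
-- the value into one piece per occurrence. Every term is a CBV normal form or has a step, and a
-- tight derivation of a normal form p has counters (0, 0, |p|_v). Reducing as long as possible
-- therefore ends, since the derivation size decreases, in a normal form reached by exactly m dB-
-- and e sv-steps.

module Submission where

open import Defs
open import Level using (0ℓ)
open import Algebra.Bundles using (CommutativeMonoid)
open import Algebra.Structures.Biased using (isCommutativeMonoidˡ)
import Algebra.Properties.CommutativeSemigroup as CommutativeSemigroupProperties
open import Data.Nat using (ℕ; zero; suc; compare; less; equal; greater) renaming (_+_ to _+ℕ_)
import Data.Nat.Properties as ℕ
open import Data.Integer using (ℤ; +_; 0ℤ; 1ℤ; -_) renaming (_+_ to _+ℤ_)
import Data.Integer.Properties as ℤ
open import Data.List using ([]; _∷_; _++_; [_]; length)
import Data.List.Properties as List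
open import Data.List.Relation.Unary.All using (All; []; _∷_)
import Data.List.Relation.Unary.All.Properties as All
open import Data.Product using (Σ; ∃; ∃₂; _×_; _,_; proj₁; proj₂)
open import Data.Sum using (_⊎_; inj₁; inj₂)
open import Data.Empty using (⊥; ⊥-elim)
open import Function using (_∘_)
open import Relation.Binary.PropositionalEquality
  using (_≡_; _≗_; refl; sym; cong; cong₂; subst; subst₂; module ≡-Reasoning)
  renaming (trans to ≡-trans)

variable
  x : ℕ
  n n' n₁ n₂ : ℕ
  σ σ' τ ρ : Ty
  A A' B B' M M' N L : MTy
  Γ Γ' Γ₁ Γ₂ Δ Δ₁ Δ₂ : Ctx
  t t' u u' b v r : Tm

≈T-refl : ∀ σ → σ ≈T σ
≈M-refl : ∀ M → M ≈M M
≈T-refl tn        = ≈n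
≈T-refl tvl       = ≈vl
≈T-refl tvr       = ≈vr
≈T-refl (mult M)  = ≈mult (≈M-refl M)
≈T-refl (arr M σ) = ≈arr (≈M-refl M) (≈T-refl σ)
≈M-refl []      = []
≈M-refl (σ ∷ M) = ≈T-refl σ ∷ ≈M-refl M

≈T-sym : σ ≈T τ → τ ≈T σ
≈M-sym : M ≈M N → N ≈M M
≈T-sym ≈n         = ≈n
≈T-sym ≈vl        = ≈vl
≈T-sym ≈vr        = ≈vr
≈T-sym (≈mult p)  = ≈mult (≈M-sym p)
≈T-sym (≈arr p q) = ≈arr (≈M-sym p) (≈T-sym q)
≈M-sym []           = []
≈M-sym (p ∷ q)      = ≈T-sym p ∷ ≈M-sym q
≈M-sym (swap σ τ M) = swap τ σ M
≈M-sym (trans p q)  = trans (≈M-sym q) (≈M-sym p)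

≈T-trans : σ ≈T τ → τ ≈T ρ → σ ≈T ρ
≈T-trans ≈n         ≈n         = ≈n
≈T-trans ≈vl        ≈vl        = ≈vl
≈T-trans ≈vr        ≈vr        = ≈vr
≈T-trans (≈mult p)  (≈mult q)  = ≈mult (trans p q)
≈T-trans (≈arr p a) (≈arr q c) = ≈arr (trans p q) (≈T-trans a c)

≡⇒≈M : M ≡ N → M ≈M N
≡⇒≈M {M} refl = ≈M-refl M

++-congˡ : M ≈M M' → ∀ B → (M ++ B) ≈M (M' ++ B)
++-congˡ []           B = ≈M-refl B
++-congˡ (p ∷ q)      B = p ∷ ++-congˡ q B
++-congˡ (swap σ τ M) B = swap σ τ (M ++ B)
++-congˡ (trans p q)  B = trans (++-congˡ p B) (++-congˡ q B)

++-congʳ : ∀ A → M ≈M M' → (A ++ M) ≈M (A ++ M')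
++-congʳ []      p = p
++-congʳ (σ ∷ A) p = ≈T-refl σ ∷ ++-congʳ A p

++-cong : A ≈M A' → B ≈M B' → (A ++ B) ≈M (A' ++ B')
++-cong {A' = A'} {B = B} p q = trans (++-congˡ p B) (++-congʳ A' q)

∷-++-comm : ∀ σ A B → (σ ∷ (A ++ B)) ≈M (A ++ (σ ∷ B))
∷-++-comm σ []      B = ≈M-refl _
∷-++-comm σ (τ ∷ A) B = trans (swap σ τ (A ++ B)) (≈T-refl τ ∷ ∷-++-comm σ A B)

++-comm : ∀ A B → (A ++ B) ≈M (B ++ A)
++-comm []      B = ≡⇒≈M (sym (List.++-identityʳ B))
++-comm (σ ∷ A) B = trans (≈T-refl σ ∷ ++-comm A B) (∷-++-comm σ B A)

++-commutativeMonoid : CommutativeMonoid 0ℓ 0ℓ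
++-commutativeMonoid = record
  { _≈_ = _≈M_
  ; _∙_ = _++_
  ; ε   = []
  ; isCommutativeMonoid = isCommutativeMonoidˡ record
    { isSemigroup = record
      { isMagma = record
        { isEquivalence = record { refl = ≈M-refl _ ; sym = ≈M-sym ; trans = trans }
        ; ∙-cong        = ++-cong }
      ; assoc = λ A B C → ≡⇒≈M (List.++-assoc A B C) }
    ; identityˡ = ≈M-refl
    ; comm      = ++-comm }
  }

module ++ = CommutativeMonoid ++-commutativeMonoid

infix 4 _≈C_
_≈C_ : Ctx → Ctx → Set
Γ ≈C Δ = ∀ y → Γ y ≈M Δ y

⊕-commutativeMonoid : CommutativeMonoid 0ℓ 0ℓ
⊕-commutativeMonoid = record
  { _≈_ = _≈C_
  ; _∙_ = _⊕_
  ; ε   = ∅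
  ; isCommutativeMonoid = isCommutativeMonoidˡ record
    { isSemigroup = record
      { isMagma = record
        { isEquivalence = record
          { refl  = λ y → ++.refl
          ; sym   = λ p y → ++.sym (p y)
          ; trans = λ p q y → ++.trans (p y) (q y) }
        ; ∙-cong = λ p q y → ++.∙-cong (p y) (q y) }
      ; assoc = λ Γ Δ Θ y → ++.assoc (Γ y) (Δ y) (Θ y) }
    ; identityˡ = λ Γ y → ++.identityˡ (Γ y)
    ; comm      = λ Γ Δ y → ++.comm (Γ y) (Δ y) }
  }

module ⊕ where
  open CommutativeMonoid ⊕-commutativeMonoid public
  open CommutativeSemigroupProperties commutativeSemigroup public

≡⇒≈C : Γ ≗ Δ → Γ ≈C Δ
≡⇒≈C p y = ≡⇒≈M (p y)

drop0-cong : Γ ≈C Γ' → drop0 Γ ≈C drop0 Γ'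
drop0-cong p y = p (suc y)

single : ℕ → MTy → Ctx
single zero    M zero    = M
single zero    M (suc y) = []
single (suc x) M zero    = []
single (suc x) M (suc y) = single x M y

↦≗single : ∀ x M → (x ↦ M) ≗ single x M
↦≗single zero    M zero    = refl
↦≗single zero    M (suc y) = refl
↦≗single (suc x) M zero    = refl
↦≗single (suc x) M (suc y) = ↦≗single x M y

single-self : ∀ x M → single x M x ≡ M
single-self zero    M = refl
single-self (suc x) M = single-self x M

single-cong : ∀ x → M ≈M N → single x M ≈C single x N
single-cong zero    p zero    = p
single-cong zero    p (suc y) = []
single-cong (suc x) p zero    = []
single-cong (suc x) p (suc y) = single-cong x p y

single-++ : ∀ x A B → single x (A ++ B) ≗ single x A ⊕ single x B
single-++ zero    A B zero    = refl
single-++ zero    A B (suc y) = refl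
single-++ (suc x) A B zero    = refl
single-++ (suc x) A B (suc y) = single-++ x A B y

single-[] : ∀ x → single x [] ≗ ∅
single-[] zero    zero    = refl
single-[] zero    (suc y) = refl
single-[] (suc x) zero    = refl
single-[] (suc x) (suc y) = single-[] x y

IsTight-resp : σ ≈T τ → IsTight σ → IsTight τ
IsTight-resp ≈n  tight-n  = tight-n
IsTight-resp ≈vl tight-vl = tight-vl
IsTight-resp ≈vr tight-vr = tight-vr

All-resp-≈M : {P : Ty → Set} → (∀ {σ τ} → σ ≈T τ → P σ → P τ) → M ≈M N → All P M → All P N
All-resp-≈M f []           []           = []
All-resp-≈M f (p ∷ q)      (x ∷ xs)     = f p x ∷ All-resp-≈M f q xs
All-resp-≈M f (swap σ τ M) (x ∷ y ∷ xs) = y ∷ x ∷ xs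
All-resp-≈M f (trans p q)  xs           = All-resp-≈M f q (All-resp-≈M f p xs)

TightM-resp : M ≈M N → TightM M → TightM N
TightM-resp = All-resp-≈M IsTight-resp

TightCtx-⊕ : TightCtx Γ → Γ ≈C Γ₁ ⊕ Γ₂ → TightCtx Γ₁ × TightCtx Γ₂
TightCtx-⊕ {Γ₁ = Γ₁} tΓ p =
  (λ y → All.++⁻ˡ (Γ₁ y) (TightM-resp (p y) (tΓ y))) ,
  (λ y → All.++⁻ʳ (Γ₁ y) (TightM-resp (p y) (tΓ y)))

Counters : Set
Counters = ℤ × ℤ × ℤ

infixl 6 _⊹_
_⊹_ : Counters → Counters → Counters
(m , e , s) ⊹ (m' , e' , s') = m +ℤ m' , e +ℤ e' , s +ℤ s'

variable
  c c' c₁ c₂ : Counters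
  m e s : ℤ

ε₀ εₘ εₑ εₛ εₘₑ : Counters
ε₀  = 0ℤ , 0ℤ , 0ℤ
εₘ  = 1ℤ , 0ℤ , 0ℤ
εₑ  = 0ℤ , 1ℤ , 0ℤ
εₛ  = 0ℤ , 0ℤ , 1ℤ
εₘₑ = 1ℤ , - 1ℤ , 0ℤ

pointwise : ∀ {a b c a' b' c' : ℤ} → a ≡ a' → b ≡ b' → c ≡ c' → (a , b , c) ≡ (a' , b' , c')
pointwise refl refl refl = refl

⊹-commutativeMonoid : CommutativeMonoid 0ℓ 0ℓ
⊹-commutativeMonoid = record
  { _≈_ = _≡_
  ; _∙_ = _⊹_
  ; ε   = ε₀
  ; isCommutativeMonoid = isCommutativeMonoidˡ record
    { isSemigroup = record
      { isMagma = record
        { isEquivalence = record { refl = refl ; sym = sym ; trans = ≡-trans }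
        ; ∙-cong = cong₂ _⊹_ }
      ; assoc = λ (a , b , c) (a' , b' , c') (a'' , b'' , c'') →
          pointwise (ℤ.+-assoc a a' a'') (ℤ.+-assoc b b' b'') (ℤ.+-assoc c c' c'') }
    ; identityˡ = λ (a , b , c) → pointwise (ℤ.+-identityˡ a) (ℤ.+-identityˡ b) (ℤ.+-identityˡ c)
    ; comm = λ (a , b , c) (a' , b' , c') → pointwise (ℤ.+-comm a a') (ℤ.+-comm b b') (ℤ.+-comm c c') }
  }

module ⊹ where
  open CommutativeMonoid ⊹-commutativeMonoid public
  open CommutativeSemigroupProperties commutativeSemigroup public

module ℕ+ = CommutativeSemigroupProperties ℕ.+-commutativeSemigroup

⊹-interchange-under : ∀ a b c d κ → a ⊹ c ⊹ (b ⊹ d) ⊹ κ ≡ a ⊹ b ⊹ κ ⊹ (c ⊹ d)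
⊹-interchange-under a b c d κ = begin
  a ⊹ c ⊹ (b ⊹ d) ⊹ κ  ≡⟨ cong (_⊹ κ) (⊹.interchange a c b d) ⟩
  a ⊹ b ⊹ (c ⊹ d) ⊹ κ  ≡⟨ ⊹.xy∙z≈xz∙y (a ⊹ b) (c ⊹ d) κ ⟩
  a ⊹ b ⊹ κ ⊹ (c ⊹ d)  ∎
  where open ≡-Reasoning

⊹-pullˡ : ∀ k a b κ → k ⊹ (a ⊹ b ⊹ κ) ≡ k ⊹ a ⊹ b ⊹ κ
⊹-pullˡ k a b κ = begin
  k ⊹ (a ⊹ b ⊹ κ)  ≡⟨ ⊹.assoc k (a ⊹ b) κ ⟨
  k ⊹ (a ⊹ b) ⊹ κ  ≡⟨ cong (_⊹ κ) (⊹.assoc k a b) ⟨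
  k ⊹ a ⊹ b ⊹ κ    ∎
  where open ≡-Reasoning

⊹-pullʳ : ∀ k a b κ → k ⊹ (a ⊹ b ⊹ κ) ≡ a ⊹ (k ⊹ b) ⊹ κ
⊹-pullʳ k a b κ = ≡-trans (⊹-pullˡ k a b κ) (cong (_⊹ κ) (⊹.xy∙z≈y∙xz k a b))

⊹-swap-under : ∀ a b c κ → a ⊹ b ⊹ κ ⊹ c ≡ a ⊹ c ⊹ b ⊹ κ
⊹-swap-under a b c κ = ≡-trans (⊹.xy∙z≈xz∙y (a ⊹ b) κ c) (cong (_⊹ κ) (⊹.xy∙z≈xz∙y a b c))

-- The +1 that abs_c adds to e is cancelled by the −1 of app_c, leaving one m-step.
abs-app-counters : ∀ a b → εₘ ⊹ (a ⊹ b) ≡ εₑ ⊹ a ⊹ b ⊹ εₘₑ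
abs-app-counters a b = begin
  εₘ ⊹ (a ⊹ b)        ≡⟨⟩
  εₑ ⊹ εₘₑ ⊹ (a ⊹ b)  ≡⟨ ⊹.xy∙z≈xz∙y εₑ εₘₑ (a ⊹ b) ⟩
  εₑ ⊹ (a ⊹ b) ⊹ εₘₑ  ≡⟨ cong (_⊹ εₘₑ) (⊹.assoc εₑ a b) ⟨
  εₑ ⊹ a ⊹ b ⊹ εₘₑ    ∎
  where open ≡-Reasoning

size-assoc : ∀ a b c → suc (a +ℕ b) +ℕ c ≡ a +ℕ suc (b +ℕ c)
size-assoc a b c = ≡-trans (cong suc (ℕ.+-assoc a b c)) (sym (ℕ.+-suc a (b +ℕ c)))

-- A copy of V whose judgements also record the size n of the derivation and which is closed
-- under ≈ (conv), so that inversion holds up to permutation of multisets. The counters (m, e, s)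
-- form one triple, and ρ fits M merges the two variants of es and app: es_c/app_c when ρ is a
-- multitype equivalent to M, es_p/appt_c when ρ = n and M is tight. As abs_c weighs nothing,
-- app_c weighs 2 so that a dB step still shrinks the derivation.

infix 3 _⊩⟨_⟩_∶_#_
data _⊩⟨_⟩_∶_#_ : Ctx → Counters → Tm → Ty → ℕ → Set
data Prems (t : Tm) : Ctx → Counters → MTy → ℕ → Set

infix 4 _fits_
data _fits_ : Ty → MTy → Set where
  mult-fits : M' ≈M M → mult M' fits M
  n-fits    : TightM M → tn fits M

data _⊩⟨_⟩_∶_#_ where
  var-p : ∀ x → single x [ tvr ] ⊩⟨ ε₀ ⟩ var x ∶ tvr # 0
  val-p : ∀ x → ∅ ⊩⟨ ε₀ ⟩ var x ∶ tvl # 0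
  abs-p : ∀ t → ∅ ⊩⟨ ε₀ ⟩ lam t ∶ tvl # 0
  app-p : ∀ {tt₁ tt₂} →
          Γ ⊩⟨ c₁ ⟩ t ∶ tt₁ # n₁ → VrOrN tt₁ → Δ ⊩⟨ c₂ ⟩ u ∶ tt₂ # n₂ → VlOrN tt₂ →
          Γ ⊕ Δ ⊩⟨ c₁ ⊹ c₂ ⊹ εₛ ⟩ app t u ∶ tn # suc (n₁ +ℕ n₂)
  var-c : ∀ x M → single x M ⊩⟨ εₑ ⟩ var x ∶ mult M # 0
  app-c : Γ ⊩⟨ c₁ ⟩ t ∶ mult [ arr M τ ] # n₁ → Δ ⊩⟨ c₂ ⟩ u ∶ ρ # n₂ → ρ fits M →
          Γ ⊕ Δ ⊩⟨ c₁ ⊹ c₂ ⊹ εₘₑ ⟩ app t u ∶ τ # suc (suc (n₁ +ℕ n₂))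
  abs-c : Prems t Γ c M n → Γ ⊩⟨ εₑ ⊹ c ⟩ lam t ∶ mult M # n
  esub  : Γ ⊩⟨ c₁ ⟩ t ∶ σ # n₁ → Δ ⊩⟨ c₂ ⟩ u ∶ ρ # n₂ → ρ fits Γ 0 →
          drop0 Γ ⊕ Δ ⊩⟨ c₁ ⊹ c₂ ⟩ es t u ∶ σ # suc (n₁ +ℕ n₂)
  conv  : Γ ⊩⟨ c ⟩ t ∶ σ # n → Γ' ≈C Γ → σ' ≈T σ → Γ' ⊩⟨ c ⟩ t ∶ σ' # n

data Prems t where
  []   : Prems t ∅ ε₀ [] 0
  cons : Γ ⊩⟨ c₁ ⟩ t ∶ τ # n₁ → A ≈M Γ 0 → Prems t Δ c₂ M n₂ →
         Prems t (drop0 Γ ⊕ Δ) (c₁ ⊹ c₂) (arr A τ ∷ M) (n₁ +ℕ n₂)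
  conv : Prems t Γ c M n → Γ' ≈C Γ → Prems t Γ' c M n

conv-ctx : Γ ⊩⟨ c ⟩ t ∶ σ # n → Γ' ≈C Γ → Γ' ⊩⟨ c ⟩ t ∶ σ # n
conv-ctx d γ = conv d γ (≈T-refl _)

cast : c ≡ c' → n ≡ n' → Γ ⊩⟨ c ⟩ t ∶ σ # n → Γ ⊩⟨ c' ⟩ t ∶ σ # n'
cast refl refl d = d

subst-term : t ≡ t' → Γ ⊩⟨ c ⟩ t ∶ σ # n → Γ ⊩⟨ c ⟩ t' ∶ σ # n
subst-term refl d = d

fits-resp : M ≈M N → ρ fits M → ρ fits N
fits-resp p (mult-fits q) = mult-fits (trans q p)
fits-resp p (n-fits tM)   = n-fits (TightM-resp p tM)

instrument : Γ ⊢⟨ m , e , s ⟩ t ∶ σ → ∃ λ n → Γ ⊩⟨ m , e , s ⟩ t ∶ σ # n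
instrumentPrems : AbsPrem t Γ m e s M → ∃ λ n → Prems t Γ (m , e , s) M n
instrument (var-p x)   = 0 , conv (var-p x) (≡⇒≈C (↦≗single x _)) ≈vr
instrument (val-p x)   = 0 , val-p x
instrument (abs-p t)   = 0 , abs-p t
instrument (var-c x M) = 0 , conv-ctx (var-c x M) (≡⇒≈C (↦≗single x M))
instrument (app-p d a d' b) with instrument d | instrument d'
... | _ , D | _ , D' =
  _ , cast (pointwise (ℤ.+-identityʳ _) (ℤ.+-identityʳ _) refl) refl (app-p D a D' b)
instrument (app-c d d' q) with instrument d | instrument d'
... | _ , D | _ , D' =
  _ , cast (pointwise refl refl (ℤ.+-identityʳ _)) refl (app-c D D' (mult-fits q))
instrument (appt-c d d' tM) with instrument d | instrument d'
... | _ , D | _ , D' =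
  _ , cast (pointwise refl refl (ℤ.+-identityʳ _)) refl (app-c D D' (n-fits tM))
instrument (abs-c p) with instrumentPrems p
... | _ , P = _ , cast (pointwise (ℤ.+-identityˡ _) refl (ℤ.+-identityˡ _)) refl (abs-c P)
instrument (es-p d d' tM) with instrument d | instrument d'
... | _ , D | _ , D' = _ , esub D D' (n-fits tM)
instrument (es-c d d' q) with instrument d | instrument d'
... | _ , D | _ , D' = _ , esub D D' (mult-fits q)
instrumentPrems []      = 0 , []
instrumentPrems (d ∷ p) with instrument d | instrumentPrems p
... | _ , D | _ , P = _ , cons D (≈M-refl _) P

data VarInv (x : ℕ) (Γ : Ctx) (σ : Ty) : Counters → ℕ → Set where
  var-p : σ ≈T tvr → Γ ≈C single x [ tvr ] → VarInv x Γ σ ε₀ 0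
  val-p : σ ≈T tvl → Γ ≈C ∅ → VarInv x Γ σ ε₀ 0
  var-c : ∀ M → σ ≈T mult M → Γ ≈C single x M → VarInv x Γ σ εₑ 0

var-inv : Γ ⊩⟨ c ⟩ var x ∶ σ # n → VarInv x Γ σ c n
var-inv (var-p x)   = var-p ≈vr ⊕.refl
var-inv (val-p x)   = val-p ≈vl ⊕.refl
var-inv (var-c x M) = var-c M (≈T-refl _) ⊕.refl
var-inv (conv d γ q) with var-inv d
... | var-p a γ'   = var-p (≈T-trans q a) (⊕.trans γ γ')
... | val-p a γ'   = val-p (≈T-trans q a) (⊕.trans γ γ')
... | var-c M a γ' = var-c M (≈T-trans q a) (⊕.trans γ γ')

data LamInv (b : Tm) (Γ : Ctx) (σ : Ty) : Counters → ℕ → Set where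
  abs-p : σ ≈T tvl → Γ ≈C ∅ → LamInv b Γ σ ε₀ 0
  abs-c : Prems b Γ c M n → σ ≈T mult M → LamInv b Γ σ (εₑ ⊹ c) n

lam-inv : Γ ⊩⟨ c ⟩ lam b ∶ σ # n → LamInv b Γ σ c n
lam-inv (abs-p _) = abs-p ≈vl ⊕.refl
lam-inv (abs-c p) = abs-c p (≈T-refl _)
lam-inv (conv d γ q) with lam-inv d
... | abs-p a γ' = abs-p (≈T-trans q a) (⊕.trans γ γ')
... | abs-c p a  = abs-c (conv p γ) (≈T-trans q a)

data AppInv (t u : Tm) (Γ : Ctx) (σ : Ty) : Counters → ℕ → Set where
  app-p : ∀ {tt₁ tt₂} →
          Γ₁ ⊩⟨ c₁ ⟩ t ∶ tt₁ # n₁ → VrOrN tt₁ → Γ₂ ⊩⟨ c₂ ⟩ u ∶ tt₂ # n₂ → VlOrN tt₂ →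
          Γ ≈C Γ₁ ⊕ Γ₂ → σ ≈T tn → AppInv t u Γ σ (c₁ ⊹ c₂ ⊹ εₛ) (suc (n₁ +ℕ n₂))
  app-c : Γ₁ ⊩⟨ c₁ ⟩ t ∶ mult [ arr M σ ] # n₁ → Γ₂ ⊩⟨ c₂ ⟩ u ∶ ρ # n₂ → ρ fits M →
          Γ ≈C Γ₁ ⊕ Γ₂ → AppInv t u Γ σ (c₁ ⊹ c₂ ⊹ εₘₑ) (suc (suc (n₁ +ℕ n₂)))

app-inv : Γ ⊩⟨ c ⟩ app t u ∶ σ # n → AppInv t u Γ σ c n
app-inv (app-p d a d' b) = app-p d a d' b ⊕.refl ≈n
app-inv (app-c d d' f)   = app-c d d' f ⊕.refl
app-inv (conv d γ q) with app-inv d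
... | app-p d₁ a d₂ b γ' q' = app-p d₁ a d₂ b (⊕.trans γ γ') (≈T-trans q q')
... | app-c {M = M} d₁ d₂ f γ' =
  app-c (conv d₁ ⊕.refl (≈mult (≈arr (≈M-refl M) q ∷ []))) d₂ f (⊕.trans γ γ')

data EsInv (t u : Tm) (Γ : Ctx) (σ : Ty) : Counters → ℕ → Set where
  esub : Γ₁ ⊩⟨ c₁ ⟩ t ∶ σ # n₁ → Γ₂ ⊩⟨ c₂ ⟩ u ∶ ρ # n₂ → ρ fits Γ₁ 0 →
         Γ ≈C drop0 Γ₁ ⊕ Γ₂ → EsInv t u Γ σ (c₁ ⊹ c₂) (suc (n₁ +ℕ n₂))

es-inv : Γ ⊩⟨ c ⟩ es t u ∶ σ # n → EsInv t u Γ σ c n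
es-inv (esub d d' f) = esub d d' f ⊕.refl
es-inv (conv d γ q) with es-inv d
... | esub d₁ d₂ f γ' = esub (conv d₁ ⊕.refl q) d₂ f (⊕.trans γ γ')

shiftVar : ℕ → ℕ → ℕ → ℕ
shiftVar d zero    x       = x +ℕ d
shiftVar d (suc k) zero    = zero
shiftVar d (suc k) (suc x) = suc (shiftVar d k x)

shiftVar-below : ∀ d x i → shiftVar d (suc (x +ℕ i)) x ≡ x
shiftVar-below d zero    i = refl
shiftVar-below d (suc x) i = cong suc (shiftVar-below d x i)

shiftVar-at : ∀ d k → shiftVar d k k ≡ k +ℕ d
shiftVar-at d zero    = refl
shiftVar-at d (suc k) = cong suc (shiftVar-at d k)

shiftVar-above : ∀ d k i → shiftVar d k (suc (k +ℕ i)) ≡ suc (k +ℕ i) +ℕ d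
shiftVar-above d zero    i = refl
shiftVar-above d (suc k) i = cong suc (shiftVar-above d k i)

shift-var : ∀ d k x → shift d k (var x) ≡ var (shiftVar d k x)
shift-var d k x with compare x k
... | less x i    = cong var (sym (shiftVar-below d x i))
... | equal x     = cong var (sym (shiftVar-at d x))
... | greater k i = cong var (sym (shiftVar-above d k i))

shiftVar-zero : ∀ k x → shiftVar 0 k x ≡ x
shiftVar-zero zero    x       = ℕ.+-identityʳ x
shiftVar-zero (suc k) zero    = refl
shiftVar-zero (suc k) (suc x) = cong suc (shiftVar-zero k x)

shiftVar-shiftVar : ∀ d d' k x → shiftVar d k (shiftVar d' k x) ≡ shiftVar (d' +ℕ d) k x
shiftVar-shiftVar d d' zero    x       = ℕ.+-assoc x d' d
shiftVar-shiftVar d d' (suc k) zero    = refl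
shiftVar-shiftVar d d' (suc k) (suc x) = cong suc (shiftVar-shiftVar d d' k x)

shift-zero : ∀ k t → shift 0 k t ≡ t
shift-zero k (var x)   = ≡-trans (shift-var 0 k x) (cong var (shiftVar-zero k x))
shift-zero k (lam t)   = cong lam (shift-zero (suc k) t)
shift-zero k (app t u) = cong₂ app (shift-zero k t) (shift-zero k u)
shift-zero k (es t u)  = cong₂ es (shift-zero (suc k) t) (shift-zero k u)

shift-shift : ∀ d d' k t → shift d k (shift d' k t) ≡ shift (d' +ℕ d) k t
shift-shift d d' k (var x) = begin
  shift d k (shift d' k (var x))       ≡⟨ cong (shift d k) (shift-var d' k x) ⟩
  shift d k (var (shiftVar d' k x))    ≡⟨ shift-var d k (shiftVar d' k x) ⟩
  var (shiftVar d k (shiftVar d' k x)) ≡⟨ cong var (shiftVar-shiftVar d d' k x) ⟩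
  var (shiftVar (d' +ℕ d) k x)         ≡⟨ shift-var (d' +ℕ d) k x ⟨
  shift (d' +ℕ d) k (var x)            ∎
  where open ≡-Reasoning
shift-shift d d' k (lam t)   = cong lam (shift-shift d d' (suc k) t)
shift-shift d d' k (app t u) = cong₂ app (shift-shift d d' k t) (shift-shift d d' k u)
shift-shift d d' k (es t u)  = cong₂ es (shift-shift d d' (suc k) t) (shift-shift d d' k u)

pad : ℕ → Ctx → Ctx
pad zero    Γ         = Γ
pad (suc d) Γ zero    = []
pad (suc d) Γ (suc y) = pad d Γ y

insert : ℕ → ℕ → Ctx → Ctx
insert zero    d Γ         = pad d Γ
insert (suc k) d Γ zero    = Γ zero
insert (suc k) d Γ (suc y) = insert k d (drop0 Γ) y

pad-⊕ : ∀ d Γ Δ → pad d (Γ ⊕ Δ) ≗ pad d Γ ⊕ pad d Δ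
pad-⊕ zero    Γ Δ y       = refl
pad-⊕ (suc d) Γ Δ zero    = refl
pad-⊕ (suc d) Γ Δ (suc y) = pad-⊕ d Γ Δ y

insert-⊕ : ∀ k d Γ Δ → insert k d (Γ ⊕ Δ) ≗ insert k d Γ ⊕ insert k d Δ
insert-⊕ zero    d Γ Δ y       = pad-⊕ d Γ Δ y
insert-⊕ (suc k) d Γ Δ zero    = refl
insert-⊕ (suc k) d Γ Δ (suc y) = insert-⊕ k d (drop0 Γ) (drop0 Δ) y

pad-cong : ∀ d → Γ ≈C Δ → pad d Γ ≈C pad d Δ
pad-cong zero    p y       = p y
pad-cong (suc d) p zero    = []
pad-cong (suc d) p (suc y) = pad-cong d p y

insert-cong : ∀ k d → Γ ≈C Δ → insert k d Γ ≈C insert k d Δ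
insert-cong zero    d p y       = pad-cong d p y
insert-cong (suc k) d p zero    = p zero
insert-cong (suc k) d p (suc y) = insert-cong k d (drop0-cong p) y

pad-∅ : ∀ d → pad d ∅ ≗ ∅
pad-∅ zero    y       = refl
pad-∅ (suc d) zero    = refl
pad-∅ (suc d) (suc y) = pad-∅ d y

insert-∅ : ∀ k d → insert k d ∅ ≗ ∅
insert-∅ zero    d y       = pad-∅ d y
insert-∅ (suc k) d zero    = refl
insert-∅ (suc k) d (suc y) = insert-∅ k d y

pad-single : ∀ d x M → pad d (single x M) ≗ single (x +ℕ d) M
pad-single zero    x M y       rewrite ℕ.+-identityʳ x = refl
pad-single (suc d) x M zero    rewrite ℕ.+-suc x d     = refl
pad-single (suc d) x M (suc y) rewrite ℕ.+-suc x d     = pad-single d x M y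

insert-single : ∀ k d x M → insert k d (single x M) ≗ single (shiftVar d k x) M
insert-single zero    d x       M y       = pad-single d x M y
insert-single (suc k) d zero    M zero    = refl
insert-single (suc k) d zero    M (suc y) = insert-∅ k d y
insert-single (suc k) d (suc x) M zero    = refl
insert-single (suc k) d (suc x) M (suc y) = insert-single k d x M y

weaken : ∀ k d → Γ ⊩⟨ c ⟩ t ∶ σ # n → insert k d Γ ⊩⟨ c ⟩ shift d k t ∶ σ # n
weakenPrems : ∀ k d → Prems t Γ c M n → Prems (shift d (suc k) t) (insert k d Γ) c M n
weaken k d (var-p x) = subst-term (sym (shift-var d k x))
  (conv (var-p _) (≡⇒≈C (insert-single k d x _)) ≈vr)
weaken k d (val-p x) = subst-term (sym (shift-var d k x))
  (conv (val-p _) (≡⇒≈C (insert-∅ k d)) ≈vl)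
weaken k d (abs-p t) = conv (abs-p _) (≡⇒≈C (insert-∅ k d)) ≈vl
weaken k d (var-c x M) = subst-term (sym (shift-var d k x))
  (conv-ctx (var-c _ M) (≡⇒≈C (insert-single k d x M)))
weaken k d (app-p {Γ = Γ} {Δ = Δ} d₁ a d₂ b) =
  conv (app-p (weaken k d d₁) a (weaken k d d₂) b) (≡⇒≈C (insert-⊕ k d Γ Δ)) ≈n
weaken k d (app-c {Γ = Γ} {Δ = Δ} d₁ d₂ f) =
  conv-ctx (app-c (weaken k d d₁) (weaken k d d₂) f) (≡⇒≈C (insert-⊕ k d Γ Δ))
weaken k d (abs-c p) = abs-c (weakenPrems k d p)
weaken k d (esub {Γ = Γ} {Δ = Δ} d₁ d₂ f) =
  conv-ctx (esub (weaken (suc k) d d₁) (weaken k d d₂) f) (≡⇒≈C (insert-⊕ k d (drop0 Γ) Δ))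
weaken k d (conv d₀ γ q) = conv (weaken k d d₀) (insert-cong k d γ) q
weakenPrems k d []         = conv [] (≡⇒≈C (insert-∅ k d))
weakenPrems k d (cons {Γ = Γ} {Δ = Δ} d₁ a p) =
  conv (cons (weaken (suc k) d d₁) a (weakenPrems k d p)) (≡⇒≈C (insert-⊕ k d (drop0 Γ) Δ))
weakenPrems k d (conv p γ) = conv (weakenPrems k d p) (insert-cong k d γ)

castPrems : c ≡ c' → n ≡ n' → Prems t Γ c M n → Prems t Γ c' M n'
castPrems refl refl p = p

cons₂ : Γ₁ ⊩⟨ c₁ ⟩ b ∶ σ # n₁ → A ≈M Γ₁ 0 → Prems b Δ c₂ (τ ∷ M) n₂ →
        Prems b (drop0 Γ₁ ⊕ Δ) (c₁ ⊹ c₂) (τ ∷ arr A σ ∷ M) (n₁ +ℕ n₂)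
cons₂ d a (conv p γ) = conv (cons₂ d a p) (⊕.∙-cong ⊕.refl γ)
cons₂ {Γ₁ = Γ₁} {c₁ = c₁} {n₁ = n₁} d a
      (cons {Γ = Γ₂} {c₁ = c₂} {n₁ = n₂} {Δ = Δ} {c₂ = c₃} {n₂ = n₃} d' a' p) =
  castPrems (⊹.x∙yz≈y∙xz c₂ c₁ c₃) (ℕ+.x∙yz≈y∙xz n₂ n₁ n₃)
    (conv (cons d' a' (cons d a p)) (⊕.x∙yz≈y∙xz (drop0 Γ₁) (drop0 Γ₂) Δ))

prems-swap : Prems b Γ c (σ ∷ τ ∷ M) n → Prems b Γ c (τ ∷ σ ∷ M) n
prems-swap (conv p γ)   = conv (prems-swap p) γ
prems-swap (cons d a p) = cons₂ d a p

prems-resp-head : Prems b Γ c (σ ∷ L) n → σ ≈T τ →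
                  (∀ {Γ c n} → Prems b Γ c L n → Prems b Γ c N n) → Prems b Γ c (τ ∷ N) n
prems-resp-head (conv p γ)   q              f = conv (prems-resp-head p q f) γ
prems-resp-head (cons d a p) (≈arr qA qτ) f =
  cons (conv d ⊕.refl (≈T-sym qτ)) (trans (≈M-sym qA) a) (f p)

prems-resp : L ≈M N → Prems b Γ c L n → Prems b Γ c N n
prems-resp []           p = p
prems-resp (q ∷ qs)     p = prems-resp-head p q (prems-resp qs)
prems-resp (swap _ _ _) p = prems-swap p
prems-resp (trans q q') p = prems-resp q' (prems-resp q p)

prems-not-vr : Prems b Γ c [ tvr ] n → ⊥
prems-not-vr (conv p _) = prems-not-vr p

data Unused (Γ : Ctx) : Counters → ℕ → Set where
  unused : Γ ≈C ∅ → Unused Γ ε₀ 0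

prems-[] : Prems b Γ c [] n → Unused Γ c n
prems-[] []         = unused ⊕.refl
prems-[] (conv p γ) with prems-[] p
... | unused γ' = unused (⊕.trans γ γ')

data PremsSplit (b : Tm) (Γ : Ctx) (A B : MTy) : Counters → ℕ → Set where
  split : Prems b Γ₁ c₁ A n₁ → Prems b Γ₂ c₂ B n₂ → Γ ≈C Γ₁ ⊕ Γ₂ →
          PremsSplit b Γ A B (c₁ ⊹ c₂) (n₁ +ℕ n₂)

prems-split : ∀ A → Prems b Γ c (A ++ B) n → PremsSplit b Γ A B c n
prems-split {b = b} {Γ = Γ} {c = c} {B = B} [] p =
  subst₂ (PremsSplit b Γ [] B) (⊹.identityˡ c) refl (split [] p (⊕.sym (⊕.identityˡ Γ)))
prems-split (σ ∷ A) (conv p γ) with prems-split (σ ∷ A) p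
... | split p₁ p₂ γ' = split p₁ p₂ (⊕.trans γ γ')
prems-split {b = b} {B = B} (arr A' τ ∷ A) (cons {Γ = Γ₀} {c₁ = c₀} {n₁ = n₀} d a p)
  with prems-split A p
... | split {Γ₁ = Γ₁} {c₁ = c₁} {n₁ = n₁} {Γ₂ = Γ₂} {c₂ = c₂} {n₂ = n₂} p₁ p₂ γ =
  subst₂ (PremsSplit b _ (arr A' τ ∷ A) B) (⊹.assoc c₀ c₁ c₂) (ℕ.+-assoc n₀ n₁ n₂)
    (split (cons d a p₁) p₂ (⊕.trans (⊕.∙-cong ⊕.refl γ) (⊕.sym (⊕.assoc (drop0 Γ₀) Γ₁ Γ₂))))

data SinglePrem (b : Tm) (Γ : Ctx) (A : MTy) (τ : Ty) : Counters → ℕ → Set where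
  single-prem : Γ₁ ⊩⟨ c ⟩ b ∶ τ # n → A ≈M Γ₁ 0 → Γ ≈C drop0 Γ₁ → SinglePrem b Γ A τ c n

prems-single : Prems b Γ c [ arr A τ ] n → SinglePrem b Γ A τ c n
prems-single (conv p γ) with prems-single p
... | single-prem d a γ' = single-prem d a (⊕.trans γ γ')
prems-single {b = b} {A = A} {τ = τ} (cons {Γ = Γ₁} {c₁ = c₁} {n₁ = n₁} d a p)
  with prems-[] p
... | unused γ = subst₂ (SinglePrem b _ A τ) (sym (⊹.identityʳ c₁)) (sym (ℕ.+-identityʳ n₁))
  (single-prem d a (⊕.trans (⊕.∙-cong ⊕.refl γ) (⊕.identityʳ (drop0 Γ₁))))

-- As typed by var_c or abs_c, but with counters c that omit the εₑ these rules add.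

infix 3 _⊩ᵛ⟨_⟩_∶_#_
data _⊩ᵛ⟨_⟩_∶_#_ : Ctx → Counters → Tm → MTy → ℕ → Set where
  val-var : ∀ y → Δ ≈C single y M → Δ ⊩ᵛ⟨ ε₀ ⟩ var y ∶ M # 0
  val-lam : Prems b Δ c M n → Δ ⊩ᵛ⟨ c ⟩ lam b ∶ M # n

value-typing : Δ ⊩ᵛ⟨ c ⟩ v ∶ M # n → Δ ⊩⟨ εₑ ⊹ c ⟩ v ∶ mult M # n
value-typing (val-var y γ) = conv-ctx (var-c y _) γ
value-typing (val-lam p)   = abs-c p

data AsValue (Δ : Ctx) (v : Tm) (M : MTy) : Counters → ℕ → Set where
  as-value : Δ ⊩ᵛ⟨ c ⟩ v ∶ M # n → AsValue Δ v M (εₑ ⊹ c) n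

as-value-typing : Value v → Δ ⊩⟨ c ⟩ v ∶ mult M # n → AsValue Δ v M c n
as-value-typing (vvar y) d with var-inv d
... | var-p () _
... | val-p () _
... | var-c N (≈mult q) γ = as-value (val-var y (⊕.trans γ (single-cong y (≈M-sym q))))
as-value-typing (vlam b) d with lam-inv d
... | abs-p () _
... | abs-c p (≈mult q) = as-value (val-lam (prems-resp (≈M-sym q) p))

value-resp : M ≈M N → Δ ⊩ᵛ⟨ c ⟩ v ∶ M # n → Δ ⊩ᵛ⟨ c ⟩ v ∶ N # n
value-resp q (val-var y γ) = val-var y (⊕.trans γ (single-cong y q))
value-resp q (val-lam p)   = val-lam (prems-resp q p)

value-weaken : Δ ⊩ᵛ⟨ c ⟩ v ∶ M # n → insert 0 1 Δ ⊩ᵛ⟨ c ⟩ shift 1 0 v ∶ M # n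
value-weaken {Δ = Δ} {M = M} (val-var y γ) =
  subst (λ t → insert 0 1 Δ ⊩ᵛ⟨ ε₀ ⟩ t ∶ M # 0) (sym (shift-var 1 0 y))
    (val-var (y +ℕ 1) (⊕.trans (insert-cong 0 1 γ) (≡⇒≈C (insert-single 0 1 y M))))
value-weaken (val-lam p) = val-lam (weakenPrems 0 1 p)

value-[] : Δ ⊩ᵛ⟨ c ⟩ v ∶ [] # n → Unused Δ c n
value-[] (val-var y γ) = unused (⊕.trans γ (≡⇒≈C (single-[] y)))
value-[] (val-lam p)   = prems-[] p

data ValueSplit (Δ : Ctx) (v : Tm) (A B : MTy) : Counters → ℕ → Set where
  split : Δ₁ ⊩ᵛ⟨ c₁ ⟩ v ∶ A # n₁ → Δ₂ ⊩ᵛ⟨ c₂ ⟩ v ∶ B # n₂ → Δ ≈C Δ₁ ⊕ Δ₂ →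
          ValueSplit Δ v A B (c₁ ⊹ c₂) (n₁ +ℕ n₂)

value-split : ∀ A → Δ ⊩ᵛ⟨ c ⟩ v ∶ A ++ B # n → ValueSplit Δ v A B c n
value-split {B = B} A (val-var y γ) =
  split (val-var y ⊕.refl) (val-var y ⊕.refl) (⊕.trans γ (≡⇒≈C (single-++ y A B)))
value-split A (val-lam p) with prems-split A p
... | split p₁ p₂ γ = split (val-lam p₁) (val-lam p₂) γ

data VrValue (Δ : Ctx) : Tm → Counters → ℕ → Set where
  vr-value : ∀ y → Δ ≈C single y [ tvr ] → VrValue Δ (var y) ε₀ 0

value-vr : Δ ⊩ᵛ⟨ c ⟩ v ∶ [ tvr ] # n → VrValue Δ v c n
value-vr (val-var y γ) = vr-value y γ
value-vr (val-lam p)   = ⊥-elim (prems-not-vr p)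

-- Substitution

skip : ℕ → ℕ → ℕ
skip zero    y       = suc y
skip (suc j) zero    = zero
skip (suc j) (suc y) = suc (skip j y)

remove : ℕ → Ctx → Ctx
remove j Γ y = Γ (skip j y)

remove-single-below : ∀ x i M → remove (suc (x +ℕ i)) (single x M) ≗ single x M
remove-single-below zero    i M zero    = refl
remove-single-below zero    i M (suc y) = refl
remove-single-below (suc x) i M zero    = refl
remove-single-below (suc x) i M (suc y) = remove-single-below x i M y

remove-single-at : ∀ x M → remove x (single x M) ≗ ∅
remove-single-at zero    M y       = refl
remove-single-at (suc x) M zero    = refl
remove-single-at (suc x) M (suc y) = remove-single-at x M y

remove-single-above : ∀ j i M → remove j (single (suc (j +ℕ i)) M) ≗ single (j +ℕ i) M
remove-single-above zero    i M y       = refl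
remove-single-above (suc j) i M zero    = refl
remove-single-above (suc j) i M (suc y) = remove-single-above j i M y

single-below : ∀ x i M → single x M (suc (x +ℕ i)) ≡ []
single-below zero    i M = refl
single-below (suc x) i M = single-below x i M

single-above : ∀ j i M → single (suc (j +ℕ i)) M j ≡ []
single-above zero    i M = refl
single-above (suc j) i M = single-above j i M

⊕-unused : Δ ≈C ∅ → Γ' ≗ Γ → Γ' ⊕ Δ ≈C Γ
⊕-unused {Γ = Γ} γ h = ⊕.trans (⊕.∙-cong (≡⇒≈C h) γ) (⊕.identityʳ Γ)

unused-⊕ : Γ' ≗ ∅ → Γ' ⊕ Δ ≈C Δ
unused-⊕ {Δ = Δ} h = ⊕.trans (⊕.∙-cong (≡⇒≈C h) ⊕.refl) (⊕.identityˡ Δ)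

⊕-split : ∀ Γ₁ Γ₂ → Δ ≈C Δ₁ ⊕ Δ₂ → (Γ₁ ⊕ Γ₂) ⊕ Δ ≈C (Γ₁ ⊕ Δ₁) ⊕ (Γ₂ ⊕ Δ₂)
⊕-split {Δ₁ = Δ₁} {Δ₂ = Δ₂} Γ₁ Γ₂ γ = ⊕.trans (⊕.∙-cong ⊕.refl γ) (⊕.interchange Γ₁ Γ₂ Δ₁ Δ₂)

value-vl : Δ ⊩ᵛ⟨ c ⟩ v ∶ M # n → ∅ ⊩⟨ ε₀ ⟩ v ∶ tvl # 0
value-vl (val-var y _) = val-p y
value-vl (val-lam {b = b} _) = abs-p b

substitute-var-p : ∀ j x → Δ ⊩ᵛ⟨ c ⟩ v ∶ single x [ tvr ] j # n →
  remove j (single x [ tvr ]) ⊕ Δ ⊩⟨ ε₀ ⊹ c ⟩ sub j v (var x) ∶ tvr # n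
substitute-var-p j x V with compare x j
... | less x i with value-[] (value-resp (≡⇒≈M (single-below x i _)) V)
...   | unused γ = conv (var-p x) (⊕-unused γ (remove-single-below x i _)) ≈vr
substitute-var-p j x V | equal x with value-vr (value-resp (≡⇒≈M (single-self x _)) V)
...   | vr-value y γ = conv (var-p y) (⊕.trans (unused-⊕ (remove-single-at x _)) γ) ≈vr
substitute-var-p j x V | greater j i with value-[] (value-resp (≡⇒≈M (single-above j i _)) V)
...   | unused γ = conv (var-p (j +ℕ i)) (⊕-unused γ (remove-single-above j i _)) ≈vr

substitute-val-p : ∀ j x → Δ ⊩ᵛ⟨ c ⟩ v ∶ [] # n → ∅ ⊕ Δ ⊩⟨ ε₀ ⊹ c ⟩ sub j v (var x) ∶ tvl # n
substitute-val-p j x V with value-[] V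
... | unused γ with compare x j
...   | less x i    = conv (val-p x) (⊕-unused γ (λ _ → refl)) ≈vl
...   | equal x     = conv (value-vl V) (⊕-unused γ (λ _ → refl)) ≈vl
...   | greater j i = conv (val-p _) (⊕-unused γ (λ _ → refl)) ≈vl

substitute-var-c : ∀ j x N → Δ ⊩ᵛ⟨ c ⟩ v ∶ single x N j # n →
  remove j (single x N) ⊕ Δ ⊩⟨ εₑ ⊹ c ⟩ sub j v (var x) ∶ mult N # n
substitute-var-c j x N V with compare x j
... | less x i with value-[] (value-resp (≡⇒≈M (single-below x i _)) V)
...   | unused γ = conv-ctx (var-c x N) (⊕-unused γ (remove-single-below x i _))
substitute-var-c j x N V | equal x =
  conv-ctx (value-typing (value-resp (≡⇒≈M (single-self x N)) V)) (unused-⊕ (remove-single-at x N))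
substitute-var-c j x N V | greater j i with value-[] (value-resp (≡⇒≈M (single-above j i _)) V)
...   | unused γ = conv-ctx (var-c (j +ℕ i) N) (⊕-unused γ (remove-single-above j i _))

substitution : ∀ j → Γ ⊩⟨ c ⟩ t ∶ σ # n → Δ ⊩ᵛ⟨ c' ⟩ v ∶ Γ j # n' →
               remove j Γ ⊕ Δ ⊩⟨ c ⊹ c' ⟩ sub j v t ∶ σ # n +ℕ n'
substitutionPrems : ∀ j → Prems b Γ c L n → Δ ⊩ᵛ⟨ c' ⟩ v ∶ Γ j # n' →
                    Prems (sub (suc j) (shift 1 0 v) b) (remove j Γ ⊕ Δ) (c ⊹ c') L (n +ℕ n')
substitution j (var-p x)   V = substitute-var-p j x V
substitution j (val-p x)   V = substitute-val-p j x V
substitution j (var-c x N) V = substitute-var-c j x N V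
substitution j (abs-p t)   V with value-[] V
... | unused γ = conv (abs-p _) (⊕-unused γ (λ _ → refl)) ≈vl
substitution j (app-p {Γ = Γ₁} {c₁ = c₁} {n₁ = n₁} {Δ = Γ₂} {c₂ = c₂} {n₂ = n₂} d₁ a d₂ b) V
  with value-split (Γ₁ j) V
... | split {c₁ = c₁'} {n₁ = n₁'} {c₂ = c₂'} {n₂ = n₂'} V₁ V₂ γ =
  cast (⊹-interchange-under c₁ c₂ c₁' c₂' εₛ) (cong suc (ℕ+.interchange n₁ n₁' n₂ n₂'))
    (conv (app-p (substitution j d₁ V₁) a (substitution j d₂ V₂) b)
          (⊕-split (remove j Γ₁) (remove j Γ₂) γ) ≈n)
substitution j (app-c {Γ = Γ₁} {c₁ = c₁} {n₁ = n₁} {Δ = Γ₂} {c₂ = c₂} {n₂ = n₂} d₁ d₂ f) V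
  with value-split (Γ₁ j) V
... | split {c₁ = c₁'} {n₁ = n₁'} {c₂ = c₂'} {n₂ = n₂'} V₁ V₂ γ =
  cast (⊹-interchange-under c₁ c₂ c₁' c₂' εₘₑ) (cong (suc ∘ suc) (ℕ+.interchange n₁ n₁' n₂ n₂'))
    (conv-ctx (app-c (substitution j d₁ V₁) (substitution j d₂ V₂) f)
              (⊕-split (remove j Γ₁) (remove j Γ₂) γ))
substitution j (abs-c {c = c} p) V =
  cast (sym (⊹.assoc εₑ c _)) refl (abs-c (substitutionPrems j p V))
substitution j (esub {Γ = Γ₁} {c₁ = c₁} {n₁ = n₁} {Δ = Γ₂} {c₂ = c₂} {n₂ = n₂} d₁ d₂ f) V
  with value-split (Γ₁ (suc j)) V
... | split {c₁ = c₁'} {n₁ = n₁'} {c₂ = c₂'} {n₂ = n₂'} V₁ V₂ γ =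
  cast (⊹.interchange c₁ c₁' c₂ c₂') (cong suc (ℕ+.interchange n₁ n₁' n₂ n₂'))
    (conv-ctx (esub (substitution (suc j) d₁ (value-weaken V₁)) (substitution j d₂ V₂)
                    (fits-resp (++.sym (++.identityʳ (Γ₁ 0))) f))
              (⊕-split (remove j (drop0 Γ₁)) (remove j Γ₂) γ))
substitution j (conv d γ q) V =
  conv (substitution j d (value-resp (γ j) V)) (⊕.∙-cong (λ y → γ (skip j y)) ⊕.refl) q
substitutionPrems j [] V with value-[] V
... | unused γ = conv [] (⊕-unused γ (λ _ → refl))
substitutionPrems j (cons {Γ = Γ₁} {c₁ = c₁} {n₁ = n₁} {Δ = Γ₂} {c₂ = c₂} {n₂ = n₂} d₁ a p) V
  with value-split (Γ₁ (suc j)) V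
... | split {c₁ = c₁'} {n₁ = n₁'} {c₂ = c₂'} {n₂ = n₂'} V₁ V₂ γ =
  castPrems (⊹.interchange c₁ c₁' c₂ c₂') (ℕ+.interchange n₁ n₁' n₂ n₂')
    (conv (cons (substitution (suc j) d₁ (value-weaken V₁)) (trans a (++.sym (++.identityʳ (Γ₁ 0))))
                (substitutionPrems j p V₂))
          (⊕-split (remove j (drop0 Γ₁)) (remove j Γ₂) γ))
substitutionPrems j (conv p γ) V =
  conv (substitutionPrems j p (value-resp (γ j) V)) (⊕.∙-cong (λ y → γ (skip j y)) ⊕.refl)

-- Subject reduction

cost : Kind → Counters
cost mul  = εₘ
cost expo = εₑ

data Reduct (k : Kind) (Γ : Ctx) (t' : Tm) (σ : Ty) : Counters → ℕ → Set where
  reduct : Γ ⊩⟨ c ⟩ t' ∶ σ # n → Reduct k Γ t' σ (cost k ⊹ c) (suc n)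

SubjectReduces : Kind → Tm → Tm → Set
SubjectReduces k t t' = ∀ {Γ c n σ} → Γ ⊩⟨ c ⟩ t ∶ σ # n → Reduct k Γ t' σ c n

castReduct : ∀ {k Γ t' σ} → c ≡ c' → n ≡ n' → Reduct k Γ t' σ c n → Reduct k Γ t' σ c' n'
castReduct refl refl r = r

reduces-subst : ∀ {k} → t' ≡ u' → SubjectReduces k t t' → SubjectReduces k t u'
reduces-subst refl red = red

app-reducesˡ : ∀ {k} → SubjectReduces k t t' → SubjectReduces k (app t u) (app t' u)
app-reducesˡ {k = k} red d with app-inv d
... | app-p {c₂ = c₂} d₁ a d₂ b γ q with red d₁
...   | reduct {c = c₁} d₁' =
  castReduct (⊹-pullˡ (cost k) c₁ c₂ εₛ) refl (reduct (conv (app-p d₁' a d₂ b) γ q))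
app-reducesˡ {k = k} red d | app-c {c₂ = c₂} d₁ d₂ f γ with red d₁
...   | reduct {c = c₁} d₁' =
  castReduct (⊹-pullˡ (cost k) c₁ c₂ εₘₑ) refl (reduct (conv-ctx (app-c d₁' d₂ f) γ))

app-reducesʳ : ∀ {k} → SubjectReduces k u u' → SubjectReduces k (app t u) (app t u')
app-reducesʳ {k = k} red d with app-inv d
... | app-p {c₁ = c₁} {n₁ = n₁} d₁ a d₂ b γ q with red d₂
...   | reduct {c = c₂} {n = n₂} d₂' =
  castReduct (⊹-pullʳ (cost k) c₁ c₂ εₛ) (cong suc (sym (ℕ.+-suc n₁ n₂)))
    (reduct (conv (app-p d₁ a d₂' b) γ q))
app-reducesʳ {k = k} red d | app-c {c₁ = c₁} {n₁ = n₁} d₁ d₂ f γ with red d₂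
...   | reduct {c = c₂} {n = n₂} d₂' =
  castReduct (⊹-pullʳ (cost k) c₁ c₂ εₘₑ) (cong (suc ∘ suc) (sym (ℕ.+-suc n₁ n₂)))
    (reduct (conv-ctx (app-c d₁ d₂' f) γ))

es-reducesˡ : ∀ {k} → SubjectReduces k t t' → SubjectReduces k (es t u) (es t' u)
es-reducesˡ {k = k} red d with es-inv d
... | esub {c₂ = c₂} d₁ d₂ f γ with red d₁
...   | reduct {c = c₁} d₁' =
  castReduct (sym (⊹.assoc (cost k) c₁ c₂)) refl (reduct (conv-ctx (esub d₁' d₂ f) γ))

es-reducesʳ : ∀ {k} → SubjectReduces k u u' → SubjectReduces k (es t u) (es t u')
es-reducesʳ {k = k} red d with es-inv d
... | esub {c₁ = c₁} {n₁ = n₁} d₁ d₂ f γ with red d₂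
...   | reduct {c = c₂} {n = n₂} d₂' =
  castReduct (⊹.x∙yz≈y∙xz (cost k) c₁ c₂) (cong suc (sym (ℕ.+-suc n₁ n₂)))
    (reduct (conv-ctx (esub d₁ d₂' f) γ))

lam-not-VrOrN : Γ ⊩⟨ c ⟩ lam b ∶ σ # n → VrOrN σ → ⊥
lam-not-VrOrN d vrn-vr with lam-inv d
... | abs-p () _
... | abs-c _ ()
lam-not-VrOrN d vrn-n with lam-inv d
... | abs-p () _
... | abs-c _ ()

value-not-n : Value v → Γ ⊩⟨ c ⟩ v ∶ tn # n → ⊥
value-not-n (vvar x) d with var-inv d
... | var-p () _
... | val-p () _
... | var-c _ () _
value-not-n (vlam b) d with lam-inv d
... | abs-p () _
... | abs-c _ ()

dB-root : SubjectReduces mul (app (lam b) u) (es b u)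
dB-root d with app-inv d
... | app-p d₁ a _ _ _ _ = ⊥-elim (lam-not-VrOrN d₁ a)
... | app-c d₁ d₂ f γ with lam-inv d₁
...   | abs-p () _
...   | abs-c p (≈mult q) with prems-single (prems-resp (≈M-sym q) p)
...     | single-prem {c = c₁} db a γ' =
  castReduct (abs-app-counters c₁ _) refl
    (reduct (conv-ctx (esub db d₂ (fits-resp a f)) (⊕.trans γ (⊕.∙-cong γ' ⊕.refl))))

sv-root : Value v → SubjectReduces expo (es t v) (t [0≔ v ])
sv-root Vv d with es-inv d
... | esub d₁ d₂ (n-fits _) γ = ⊥-elim (value-not-n Vv d₂)
... | esub {c₁ = c₁} d₁ d₂ (mult-fits q) γ with as-value-typing Vv d₂
...   | as-value {c = c₂} V =
  castReduct (⊹.x∙yz≈y∙xz εₑ c₁ c₂) refl (reduct (conv-ctx (substitution 0 d₁ (value-resp q V)) γ))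

-- Two typed σ-equivalences, used to move the outermost substitution of L out of a redex at distance L.

app-es-comm : Γ ⊩⟨ c ⟩ app (es t r) u ∶ τ # n → Γ ⊩⟨ c ⟩ es (app t (shift 1 0 u)) r ∶ τ # n
app-es-comm d with app-inv d
... | app-p {Γ₂ = Γᵤ} {c₂ = cᵤ} {n₂ = nᵤ} d₁ a dᵤ b γ q with es-inv d₁
...   | esub {Γ₁ = Γₜ} {c₁ = cₜ} {n₁ = nₜ} {Γ₂ = Γᵣ} {c₂ = cᵣ} {n₂ = nᵣ} dₜ dᵣ f γ' =
  cast (⊹-swap-under cₜ cᵤ cᵣ εₛ) (cong (suc ∘ suc) (ℕ+.xy∙z≈xz∙y nₜ nᵤ nᵣ))
    (conv (esub (app-p dₜ a (weaken 0 1 dᵤ) b) dᵣ (fits-resp (++.sym (++.identityʳ (Γₜ 0))) f))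
          (⊕.trans γ (⊕.trans (⊕.∙-cong γ' ⊕.refl) (⊕.xy∙z≈xz∙y (drop0 Γₜ) Γᵣ Γᵤ))) q)
app-es-comm d | app-c {Γ₂ = Γᵤ} {c₂ = cᵤ} {n₂ = nᵤ} d₁ dᵤ fᵤ γ with es-inv d₁
...   | esub {Γ₁ = Γₜ} {c₁ = cₜ} {n₁ = nₜ} {Γ₂ = Γᵣ} {c₂ = cᵣ} {n₂ = nᵣ} dₜ dᵣ f γ' =
  cast (⊹-swap-under cₜ cᵤ cᵣ εₘₑ) (cong (suc ∘ suc ∘ suc) (ℕ+.xy∙z≈xz∙y nₜ nᵤ nᵣ))
    (conv-ctx (esub (app-c dₜ (weaken 0 1 dᵤ) fᵤ) dᵣ (fits-resp (++.sym (++.identityʳ (Γₜ 0))) f))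
              (⊕.trans γ (⊕.trans (⊕.∙-cong γ' ⊕.refl) (⊕.xy∙z≈xz∙y (drop0 Γₜ) Γᵣ Γᵤ))))

es-es-assoc : Γ ⊩⟨ c ⟩ es t (es u r) ∶ σ # n → Γ ⊩⟨ c ⟩ es (es (shift 1 1 t) u) r ∶ σ # n
es-es-assoc d with es-inv d
... | esub {Γ₁ = Γₜ} {c₁ = cₜ} {n₁ = nₜ} dₜ d₂ f γ with es-inv d₂
...   | esub {Γ₁ = Γᵤ} {c₁ = cᵤ} {n₁ = nᵤ} {Γ₂ = Γᵣ} {c₂ = cᵣ} {n₂ = nᵣ} dᵤ dᵣ f' γ' =
  cast (⊹.assoc cₜ cᵤ cᵣ) (cong suc (size-assoc nₜ nᵤ nᵣ))
    (conv-ctx (esub (esub (weaken 1 1 dₜ) dᵤ f) dᵣ f')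
              (⊕.trans γ (⊕.trans (⊕.∙-cong ⊕.refl γ') (⊕.sym (⊕.assoc (drop0 Γₜ) (drop0 Γᵤ) Γᵣ)))))

dB-reduces : ∀ L → SubjectReduces mul (app (plug L (lam b)) u) (plug L (es b (shift (length L) 0 u)))
dB-reduces {b = b} {u = u} [] = reduces-subst (cong (es b) (sym (shift-zero 0 u))) dB-root
dB-reduces {b = b} {u = u} (r ∷ L) d = es-reducesˡ
  (reduces-subst (cong (λ w → plug L (es b w)) (shift-shift (length L) 1 0 u)) (dB-reduces L))
  (app-es-comm d)

sv-reduces : ∀ L → Value v →
             SubjectReduces expo (es t (plug L v)) (plug L ((shift (length L) 1 t) [0≔ v ]))
sv-reduces {v = v} {t = t} [] Vv = reduces-subst (cong (_[0≔ v ]) (sym (shift-zero 1 t))) (sv-root Vv)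
sv-reduces {v = v} {t = t} (r ∷ L) Vv d = es-reducesˡ
  (reduces-subst (cong (λ w → plug L (w [0≔ v ])) (shift-shift (length L) 1 1 t)) (sv-reduces L Vv))
  (es-es-assoc d)

subject-reduction : ∀ {k} → t ⟶[ k ] t' → SubjectReduces k t t'
subject-reduction (dB L b u)    = dB-reduces L
subject-reduction (sv t L v Vv) = sv-reduces L Vv
subject-reduction (appL u st)   = app-reducesˡ (subject-reduction st)
subject-reduction (appR t st)   = app-reducesʳ (subject-reduction st)
subject-reduction (esL u st)    = es-reducesˡ (subject-reduction st)
subject-reduction (esR t st)    = es-reducesʳ (subject-reduction st)

-- Tight typings of normal forms

normal : Tm → Counters
normal t = 0ℤ , 0ℤ , + size t

tight-not-mult : IsTight σ → σ ≈T mult M → ⊥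
tight-not-mult tight-n  ()
tight-not-mult tight-vl ()
tight-not-mult tight-vr ()

VrOrN-tight : VrOrN σ → IsTight σ
VrOrN-tight vrn-vr = tight-vr
VrOrN-tight vrn-n  = tight-n

VlOrN-tight : VlOrN σ → IsTight σ
VlOrN-tight vln-vl = tight-vl
VlOrN-tight vln-n  = tight-n

TightCtx-esub : TightCtx Γ → Γ ≈C drop0 Γ₁ ⊕ Γ₂ → tn fits Γ₁ 0 → TightCtx Γ₁ × TightCtx Γ₂
TightCtx-esub {Γ₁ = Γ₁} tΓ γ (n-fits t0) with TightCtx-⊕ {Γ₁ = drop0 Γ₁} tΓ γ
... | tΓ₁ , tΓ₂ = (λ { zero → t0 ; (suc y) → tΓ₁ y }) , tΓ₂

data TightEs (t u : Tm) (σ : Ty) : Counters → Set where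
  tight-es : Γ₁ ⊩⟨ c ⟩ t ∶ σ # n → TightCtx Γ₁ → TightEs t u σ (c ⊹ normal u)

vr-typing    : VrV t → Γ ⊩⟨ c ⟩ t ∶ σ # n → TightCtx Γ → IsTight σ → c ≡ normal t
vr-mult      : VrV t → Γ ⊩⟨ c ⟩ t ∶ σ # n → TightCtx Γ → σ ≈T mult L → TightM L
ne-typing    : NeV t → Γ ⊩⟨ c ⟩ t ∶ σ # n → TightCtx Γ → σ ≈T tn × c ≡ normal t
no-typing    : NoV t → Γ ⊩⟨ c ⟩ t ∶ σ # n → TightCtx Γ → IsTight σ → c ≡ normal t
tight-es-inv : NeV u → Γ ⊩⟨ c ⟩ es t u ∶ σ # n → TightCtx Γ → TightEs t u σ c

tight-es-inv nu d tΓ with es-inv d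
... | esub d₁ d₂ f γ with ne-typing nu d₂ (proj₂ (TightCtx-⊕ tΓ γ))
...   | ≈n , refl = tight-es d₁ (proj₁ (TightCtx-esub tΓ γ f))

vr-typing (vr-var x) d tΓ tσ with var-inv d
... | var-p _ _   = refl
... | val-p _ _   = refl
... | var-c _ q _ = ⊥-elim (tight-not-mult tσ q)
vr-typing (vr-es vt nu) d tΓ tσ with tight-es-inv nu d tΓ
... | tight-es d₁ tΓ₁ with vr-typing vt d₁ tΓ₁ tσ
...   | refl = refl

vr-mult (vr-var x) d tΓ q with var-inv d
... | var-p a _ with ≈T-trans (≈T-sym a) q
...   | ()
vr-mult (vr-var x) d tΓ q | val-p a _ with ≈T-trans (≈T-sym a) q
...   | ()
vr-mult (vr-var x) d tΓ q | var-c M a γ with ≈T-trans (≈T-sym a) q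
...   | ≈mult r = TightM-resp r (subst TightM (single-self x M) (TightM-resp (γ x) (tΓ x)))
vr-mult (vr-es vt nu) d tΓ q with tight-es-inv nu d tΓ
... | tight-es d₁ tΓ₁ = vr-mult vt d₁ tΓ₁ q

ne-typing (ne-vr vt nu) d tΓ with app-inv d
... | app-p d₁ a d₂ b γ q with TightCtx-⊕ tΓ γ
...   | tΓ₁ , tΓ₂ with vr-typing vt d₁ tΓ₁ (VrOrN-tight a) | no-typing nu d₂ tΓ₂ (VlOrN-tight b)
...     | refl | refl = q , refl
ne-typing (ne-vr vt nu) d tΓ | app-c d₁ d₂ f γ with vr-mult vt d₁ (proj₁ (TightCtx-⊕ tΓ γ)) (≈T-refl _)
...   | () ∷ _
ne-typing (ne-ne nt nu) d tΓ with app-inv d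
... | app-p d₁ a d₂ b γ q with TightCtx-⊕ tΓ γ
...   | tΓ₁ , tΓ₂ with ne-typing nt d₁ tΓ₁ | no-typing nu d₂ tΓ₂ (VlOrN-tight b)
...     | _ , refl | refl = q , refl
ne-typing (ne-ne nt nu) d tΓ | app-c d₁ d₂ f γ with ne-typing nt d₁ (proj₁ (TightCtx-⊕ tΓ γ))
...   | () , _
ne-typing (ne-es nt nu) d tΓ with tight-es-inv nu d tΓ
... | tight-es d₁ tΓ₁ with ne-typing nt d₁ tΓ₁
...   | q , refl = q , refl

no-typing (no-lam t) d tΓ tσ with lam-inv d
... | abs-p _ _ = refl
... | abs-c _ q = ⊥-elim (tight-not-mult tσ q)
no-typing (no-vr vt) d tΓ tσ = vr-typing vt d tΓ tσ
no-typing (no-ne nt) d tΓ tσ = proj₂ (ne-typing nt d tΓ)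
no-typing (no-es nt nu) d tΓ tσ with tight-es-inv nu d tΓ
... | tight-es d₁ tΓ₁ with no-typing nt d₁ tΓ₁ tσ
...   | refl = refl

-- Progress and normalisation

no-view : NoV t → (∃₂ λ L b → t ≡ plug L (lam b)) ⊎ VrV t ⊎ NeV t
no-view (no-lam t) = inj₁ ([] , t , refl)
no-view (no-vr v)  = inj₂ (inj₁ v)
no-view (no-ne n)  = inj₂ (inj₂ n)
no-view (no-es {u = u} nt nu) with no-view nt
... | inj₁ (L , b , refl) = inj₁ (u ∷ L , b , refl)
... | inj₂ (inj₁ v)       = inj₂ (inj₁ (vr-es v nu))
... | inj₂ (inj₂ n)       = inj₂ (inj₂ (ne-es n nu))

vr-view : VrV t → ∃₂ λ L x → t ≡ plug L (var x)
vr-view (vr-var x) = [] , x , refl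
vr-view (vr-es {u = u} v nu) with vr-view v
... | L , x , refl = u ∷ L , x , refl

progress : ∀ t → NoV t ⊎ ∃₂ λ k t' → t ⟶[ k ] t'
progress (var x) = inj₁ (no-vr (vr-var x))
progress (lam t) = inj₁ (no-lam t)
progress (app t u) with progress t
... | inj₂ (k , t' , st) = inj₂ (k , _ , appL u st)
... | inj₁ nt with no-view nt
...   | inj₁ (L , b , refl) = inj₂ (mul , _ , dB L b u)
...   | inj₂ head with progress u
...     | inj₂ (k , u' , st) = inj₂ (k , _ , appR t st)
...     | inj₁ nu with head
...       | inj₁ vt = inj₁ (no-ne (ne-vr vt nu))
...       | inj₂ nt' = inj₁ (no-ne (ne-ne nt' nu))
progress (es t u) with progress u
... | inj₂ (k , u' , st) = inj₂ (k , _ , esR t st)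
... | inj₁ nu with no-view nu
...   | inj₁ (L , b , refl) = inj₂ (expo , _ , sv t L (lam b) (vlam b))
...   | inj₂ (inj₁ vu) with vr-view vu
...     | L , x , refl = inj₂ (expo , _ , sv t L (var x) (vvar x))
progress (es t u) | inj₁ nu | inj₂ (inj₂ neu) with progress t
...   | inj₂ (k , t' , st) = inj₂ (k , _ , esL u st)
...   | inj₁ nt = inj₁ (no-es nt neu)

normalise : ∀ n → Γ ⊩⟨ c ⟩ t ∶ σ # n → TightCtx Γ → IsTight σ →
  Σ Tm λ p → Σ ℕ λ m' → Σ ℕ λ e' → NoV p × c ≡ (+ m' , + e' , + size p) × t ⟶*⟨ m' , e' ⟩ p
normalise {t = t} n d tΓ tσ with progress t
... | inj₁ nt = t , 0 , 0 , nt , no-typing nt d tΓ tσ , done t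
... | inj₂ (mul , t' , st) with subject-reduction st d
...   | reduct {n = n'} d' with normalise n' d' tΓ tσ
...     | p , m' , e' , np , refl , red = p , suc m' , e' , np , refl , stepm st red
normalise {t = t} n d tΓ tσ | inj₂ (expo , t' , st) with subject-reduction st d
...   | reduct {n = n'} d' with normalise n' d' tΓ tσ
...     | p , m' , e' , np , refl , red = p , m' , suc e' , np , refl , stepe st red

theorem4p8 : ∀ {Γ : Ctx} {m e s : ℤ} {t : Tm} {σ : Ty} →
    Γ ⊢⟨ m , e , s ⟩ t ∶ σ → Tight Γ σ →
    Σ Tm λ p → Σ ℕ λ m' → Σ ℕ λ e' →
      NoV p × (m ≡ + m') × (e ≡ + e') × (t ⟶*⟨ m' , e' ⟩ p) × (s ≡ + size p)
theorem4p8 d (tΓ , tσ) with instrument d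
... | n , d' with normalise n d' tΓ tσ
...   | p , m' , e' , np , refl , red = p , m' , e' , np , refl , refl , red , refl
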